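{- Let $G$ be a connected graph of diameter $2$ and let $x$ be a vertex of $G$. If $G-x$ has diameter $2$, or $x$ belongs to some general position set of $G$ of cardinality ${\rm gp}(G)$, then ${\rm gp}(G)-1\le {\rm gp}(G-x)\le {\rm gp}(G)$.
   Context: All graphs are simple. A set $X\subseteq V(G)$ is a general position set of $G$ if for every pair of distinct $u,v\in X$ and every shortest $u,v$-path $P$ in $G$ we have $V(P)\cap X=\{u,v\}$ (vertices in different components impose no condition). ${\rm gp}(G)$ is the maximum cardinality of a general position set of $G$. $G-x$ is the subgraph induced by $V(G)\setminus\{x\}$. -}

module Defs where

open import Data.Nat using (ℕ; zero; suc; _≤_)
open import Data.Fin using (Fin; punchIn)
open import Data.Fin.Subset using (Subset; _∈_; ∣_∣)
open import Data.Product using (Σ; ∃; ∃-syntax; _×_; _,_)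
open import Data.Sum using (_⊎_)
open import Relation.Binary.PropositionalEquality using (_≡_; _≢_)
open import Relation.Nullary using (¬_)

record Graph (n : ℕ) : Set₁ where
  field
    Adj   : Fin n → Fin n → Set
    sym   : ∀ {u v} → Adj u v → Adj v u
    irrefl : ∀ {u} → ¬ Adj u u
open Graph public

data Walk {n : ℕ} (G : Graph n) : Fin n → Fin n → ℕ → Set where
  []  : ∀ {u} → Walk G u u 0
  _∷_ : ∀ {u w v k} → Adj G u w → Walk G w v k → Walk G u v (suc k)

data OnWalk {n : ℕ} {G : Graph n} (z : Fin n) : ∀ {u v k} → Walk G u v k → Set where
  here  : ∀ {v k} {p : Walk G z v k} → OnWalk z p
  there : ∀ {u w v k} {e : Adj G u w} {p : Walk G w v k} → OnWalk z p → OnWalk z (e ∷ p)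

Dist : ∀ {n} → Graph n → Fin n → Fin n → ℕ → Set
Dist G u v d = Walk G u v d × (∀ k → Walk G u v k → d ≤ k)

ConnectedDiam2 : ∀ {n} → Graph n → Set
ConnectedDiam2 G =
  (∀ u v → ∃[ d ] (d ≤ 2 × Dist G u v d)) × (∃[ u ] ∃[ v ] Dist G u v 2)

-- general position set: no shortest u,v-path (u ≠ v in S) has an inner vertex in S.
-- (A walk of length d(u,v) is exactly a shortest u,v-path.)
IsGPSet : ∀ {n} → Graph n → Subset n → Set
IsGPSet G S = ∀ u v → u ∈ S → v ∈ S → u ≢ v →
  ∀ d (p : Walk G u v d) → Dist G u v d →
  ∀ z → OnWalk z p → z ∈ S → (z ≡ u) ⊎ (z ≡ v)

IsGP : ∀ {n} → Graph n → ℕ → Set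
IsGP G k = (∃[ S ] (IsGPSet G S × ∣ S ∣ ≡ k)) × (∀ S → IsGPSet G S → ∣ S ∣ ≤ k)

_-v_ : ∀ {n} → Graph (suc n) → Fin (suc n) → Graph n
G -v x = record
  { Adj = λ i j → Adj G (punchIn x i) (punchIn x j)
  ; sym = sym G
  ; irrefl = irrefl G
  }

{-# OPTIONS --safe #-}
-- In a graph of diameter 2 a shortest path has at most one interior vertex, a common
-- neighbour of its ends.  Hence a shortest u,v-path of G whose interior vertex lies in a
-- general position set T of G - x avoids x and is a shortest path of G - x, so T stays in
-- general position in G: gp(G - x) ≤ gp(G).  Conversely S ∖ {x} is in general position in
-- G - x for a general position set S of G as soon as G - x preserves the distances between
-- vertices of S.  This can only fail for u, v ∈ S at distance 2 whose sole common neighbour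
-- is x; it cannot happen if G - x has diameter 2, nor if x ∈ S, as then u x v would be a
-- shortest path with an interior vertex in S.  So gp(G) - 1 ≤ gp(G - x).
module Submission where

open import Defs
open import Data.Empty using (⊥-elim)
open import Data.Fin using (Fin; zero; suc; punchIn; punchOut) renaming (_≟_ to _≟ᶠ_)
open import Data.Fin.Properties using (punchIn-injective; punchInᵢ≢i; punchIn-punchOut)
open import Data.Fin.Subset using (Subset; _∈_; ∣_∣; inside; outside)
open import Data.Nat using (ℕ; suc; _≤_; _∸_; z≤n; s≤s)
open import Data.Nat.Properties using (≤-refl; ≤-trans; m∸n≤m)
open import Data.Product using (_×_; ∃-syntax; _,_)
open import Data.Sum using (_⊎_; inj₁; inj₂) renaming (map to ⊎-map)
open import Data.Vec using (Vec; []; _∷_; here; there; lookup; insertAt; removeAt)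
open import Data.Vec.Properties
  using (insertAt-lookup; insertAt-punchIn; insertAt-removeAt; []=⇒lookup; lookup⇒[]=)
open import Function using (_∘_)
open import Relation.Binary.PropositionalEquality
  using (_≡_; _≢_; refl; trans; cong; subst; module ≡-Reasoning) renaming (sym to ≡-sym)
open import Relation.Nullary using (yes; no)

removeAt-punchIn : ∀ {a} {A : Set a} {n : ℕ} (xs : Vec A (suc n)) i j →
                   lookup (removeAt xs i) j ≡ lookup xs (punchIn i j)
removeAt-punchIn xs i j = begin
  lookup (removeAt xs i) j
    ≡⟨ ≡-sym (insertAt-punchIn (removeAt xs i) i (lookup xs i) j) ⟩
  lookup (insertAt (removeAt xs i) i (lookup xs i)) (punchIn i j)
    ≡⟨ cong (λ ys → lookup ys (punchIn i j)) (insertAt-removeAt xs i) ⟩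
  lookup xs (punchIn i j) ∎
  where open ≡-Reasoning

∈-removeAt⁻ : ∀ {n : ℕ} (S : Subset (suc n)) x {i} → i ∈ removeAt S x → punchIn x i ∈ S
∈-removeAt⁻ S x {i} i∈ =
  lookup⇒[]= _ S (subst (_≡ inside) (removeAt-punchIn S x i) ([]=⇒lookup i∈))

∈-insertAt-outside⁻ : ∀ {n : ℕ} (T : Subset n) x {i} → i ∈ insertAt T x outside →
                      ∃[ j ] (punchIn x j ≡ i × j ∈ T)
∈-insertAt-outside⁻ T x {i} i∈ with x ≟ᶠ i
... | yes refl with () ← trans (≡-sym (insertAt-lookup T x outside)) ([]=⇒lookup i∈)
... | no x≢i = punchOut x≢i , punchIn-punchOut x≢i , lookup⇒[]= _ T lookup≡inside
  where
  open ≡-Reasoning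
  lookup≡inside : lookup T (punchOut x≢i) ≡ inside
  lookup≡inside = begin
    lookup T (punchOut x≢i)
      ≡⟨ ≡-sym (insertAt-punchIn T x outside (punchOut x≢i)) ⟩
    lookup (insertAt T x outside) (punchIn x (punchOut x≢i))
      ≡⟨ cong (lookup (insertAt T x outside)) (punchIn-punchOut x≢i) ⟩
    lookup (insertAt T x outside) i
      ≡⟨ []=⇒lookup i∈ ⟩
    inside ∎

∣insertAt∣ : ∀ {n : ℕ} (T : Subset n) x b → ∣ insertAt T x b ∣ ≡ ∣ b ∷ T ∣
∣insertAt∣ T             zero    b       = refl
∣insertAt∣ (outside ∷ T) (suc x) b       = ∣insertAt∣ T x b
∣insertAt∣ (inside ∷ T)  (suc x) outside = cong suc (∣insertAt∣ T x outside)
∣insertAt∣ (inside ∷ T)  (suc x) inside  = cong suc (∣insertAt∣ T x inside)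

∣removeAt∣ : ∀ {n : ℕ} (S : Subset (suc n)) x → ∣ S ∣ ∸ 1 ≤ ∣ removeAt S x ∣
∣removeAt∣ S x =
  subst (λ m → m ∸ 1 ≤ ∣ removeAt S x ∣) ∣S∣≡ (pred∣∷∣≤ (lookup S x) (removeAt S x))
  where
  ∣S∣≡ : ∣ lookup S x ∷ removeAt S x ∣ ≡ ∣ S ∣
  ∣S∣≡ = trans (≡-sym (∣insertAt∣ (removeAt S x) x (lookup S x)))
               (cong ∣_∣ (insertAt-removeAt S x))
  pred∣∷∣≤ : ∀ {m} b (T : Subset m) → ∣ b ∷ T ∣ ∸ 1 ≤ ∣ T ∣
  pred∣∷∣≤ inside  T = ≤-refl
  pred∣∷∣≤ outside T = m∸n≤m ∣ T ∣ 1

Diam≤2 : ∀ {m} → Graph m → Set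
Diam≤2 G = ∀ u v → ∃[ d ] (d ≤ 2 × Dist G u v d)

module _ {m : ℕ} {G : Graph m} where

  Walk-0⇒≡ : ∀ {u v} → Walk G u v 0 → u ≡ v
  Walk-0⇒≡ [] = refl

  Walk-1⇒Adj : ∀ {u v} → Walk G u v 1 → Adj G u v
  Walk-1⇒Adj (e ∷ []) = e

  Walk-2⇒commonNeighbour : ∀ {u v} → Walk G u v 2 → ∃[ w ] (Adj G u w × Adj G w v)
  Walk-2⇒commonNeighbour (e ∷ f ∷ []) = _ , e , f

  onWalk-length≤2 : ∀ {u v z d} (p : Walk G u v d) → d ≤ 2 → OnWalk z p →
                    z ≡ u ⊎ z ≡ v ⊎ (Adj G u z × Adj G z v × d ≡ 2)
  onWalk-length≤2 []               _ here                = inj₁ refl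
  onWalk-length≤2 (e ∷ [])         _ here                = inj₁ refl
  onWalk-length≤2 (e ∷ [])         _ (there here)        = inj₂ (inj₁ refl)
  onWalk-length≤2 (e ∷ f ∷ [])     _ here                = inj₁ refl
  onWalk-length≤2 (e ∷ f ∷ [])     _ (there here)        = inj₂ (inj₂ (e , f , refl))
  onWalk-length≤2 (e ∷ f ∷ [])     _ (there (there here)) = inj₂ (inj₁ refl)
  onWalk-length≤2 (e ∷ f ∷ g ∷ p) (s≤s (s≤s ())) _

  Dist-suc⇒≢ : ∀ {u v d} → Dist G u v (suc d) → u ≢ v
  Dist-suc⇒≢ (_ , minimal) refl with () ← minimal 0 []

  Dist-≤2 : Diam≤2 G → ∀ {u v d} → Dist G u v d → d ≤ 2
  Dist-≤2 diam {u} {v} (_ , minimal) with diam u v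
  ... | _ , d′≤2 , (p′ , _) = ≤-trans (minimal _ p′) d′≤2

module VertexDeletion {n : ℕ} (G : Graph (suc n)) (x : Fin (suc n)) where

  liftWalk : ∀ {u v d} → Walk (G -v x) u v d → Walk G (punchIn x u) (punchIn x v) d
  liftWalk []      = []
  liftWalk (e ∷ p) = e ∷ liftWalk p

  liftOnWalk : ∀ {z u v d} {p : Walk (G -v x) u v d} →
               OnWalk z p → OnWalk (punchIn x z) (liftWalk p)
  liftOnWalk here      = here
  liftOnWalk (there o) = there (liftOnWalk o)

  Dist-unlift : ∀ {u v d} → Walk (G -v x) u v d → Dist G (punchIn x u) (punchIn x v) d →
                Dist (G -v x) u v d
  Dist-unlift p (_ , minimal) = p , λ k q → minimal k (liftWalk q)

  insertAt-IsGPSet : Diam≤2 G → ∀ {T} →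
                     IsGPSet (G -v x) T → IsGPSet G (insertAt T x outside)
  insertAt-IsGPSet diam {T} gpT u v u∈ v∈ u≢v d p D z z∈p z∈
    with onWalk-length≤2 p (Dist-≤2 diam D) z∈p
  ... | inj₁ z≡u        = inj₁ z≡u
  ... | inj₂ (inj₁ z≡v) = inj₂ z≡v
  ... | inj₂ (inj₂ (e , f , refl))
    with ∈-insertAt-outside⁻ T x u∈ | ∈-insertAt-outside⁻ T x v∈ | ∈-insertAt-outside⁻ T x z∈
  ... | u₀ , refl , u₀∈ | v₀ , refl , v₀∈ | z₀ , refl , z₀∈ =
    ⊎-map (cong (punchIn x)) (cong (punchIn x))
      (gpT u₀ v₀ u₀∈ v₀∈ (u≢v ∘ cong (punchIn x))
           2 (e ∷ f ∷ []) (Dist-unlift (e ∷ f ∷ []) D) z₀ (there here) z₀∈)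

  PreservesDistOn : Subset (suc n) → Set
  PreservesDistOn S = ∀ u v → punchIn x u ∈ S → punchIn x v ∈ S →
    ∀ d → Dist (G -v x) u v d → Dist G (punchIn x u) (punchIn x v) d

  removeAt-IsGPSet : ∀ {S} → IsGPSet G S → PreservesDistOn S →
                     IsGPSet (G -v x) (removeAt S x)
  removeAt-IsGPSet {S} gpS preserves u v u∈ v∈ u≢v d p D z z∈p z∈ =
    ⊎-map (punchIn-injective x z u) (punchIn-injective x z v)
      (gpS (punchIn x u) (punchIn x v) u∈′ v∈′ (u≢v ∘ punchIn-injective x u v)
           d (liftWalk p) (preserves u v u∈′ v∈′ d D)
           (punchIn x z) (liftOnWalk z∈p) (∈-removeAt⁻ S x z∈))
    where
    u∈′ = ∈-removeAt⁻ S x u∈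
    v∈′ = ∈-removeAt⁻ S x v∈

  Bypassable : Subset (suc n) → Set
  Bypassable S = ∀ u v → punchIn x u ∈ S → punchIn x v ∈ S →
    Dist G (punchIn x u) (punchIn x v) 2 → Adj G (punchIn x u) x → Adj G x (punchIn x v) →
    ∃[ d ] (d ≤ 2 × Walk (G -v x) u v d)

  Diam≤2⇒Bypassable : Diam≤2 (G -v x) → ∀ {S} → Bypassable S
  Diam≤2⇒Bypassable diamH u v _ _ _ _ _ with diamH u v
  ... | d , d≤2 , (p , _) = d , d≤2 , p

  IsGPSet-∋⇒Bypassable : ∀ {S} → IsGPSet G S → x ∈ S → Bypassable S
  IsGPSet-∋⇒Bypassable gpS x∈S u v u∈ v∈ D e f
    with gpS _ _ u∈ v∈ (Dist-suc⇒≢ D) 2 (e ∷ f ∷ []) D x (there here) x∈S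
  ... | inj₁ x≡u = ⊥-elim (punchInᵢ≢i x u (≡-sym x≡u))
  ... | inj₂ x≡v = ⊥-elim (punchInᵢ≢i x v (≡-sym x≡v))

  reroute : ∀ {S} → Bypassable S → ∀ {u v d} → punchIn x u ∈ S → punchIn x v ∈ S →
            Dist G (punchIn x u) (punchIn x v) d → d ≤ 2 →
            ∃[ d′ ] (d′ ≤ d × Walk (G -v x) u v d′)
  reroute bypass {u} {v} u∈ v∈ (p , _) z≤n
    with refl ← punchIn-injective x u v (Walk-0⇒≡ p) = 0 , z≤n , []
  reroute bypass u∈ v∈ (p , _) (s≤s z≤n) = 1 , ≤-refl , Walk-1⇒Adj p ∷ []
  reroute bypass u∈ v∈ D@(p , _) (s≤s (s≤s z≤n)) with Walk-2⇒commonNeighbour p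
  ... | w , e , f with x ≟ᶠ w
  ...   | yes refl = bypass _ _ u∈ v∈ D e f
  ...   | no x≢w with punchOut x≢w | punchIn-punchOut x≢w
  ...     | w₀ | refl = 2 , ≤-refl , e ∷ f ∷ []

  Bypassable⇒PreservesDistOn : Diam≤2 G → ∀ {S} → Bypassable S → PreservesDistOn S
  Bypassable⇒PreservesDistOn diam bypass u v u∈ v∈ d (p , minimal)
    with diam (punchIn x u) (punchIn x v)
  ... | dG , dG≤2 , DG@(_ , minimalG) with reroute bypass u∈ v∈ DG dG≤2
  ...   | d′ , d′≤dG , q =
    liftWalk p , λ k r → ≤-trans (minimal d′ q) (≤-trans d′≤dG (minimalG k r))

  gp-v≤gp : Diam≤2 G → ∀ {k k′} → IsGP G k → IsGP (G -v x) k′ → k′ ≤ k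
  gp-v≤gp diam (_ , maximal) ((T , gpT , refl) , _) =
    subst (_≤ _) (∣insertAt∣ T x outside) (maximal _ (insertAt-IsGPSet diam gpT))

  gp∸1≤gp-v : ∀ {S k′} → IsGPSet G S → PreservesDistOn S →
              IsGP (G -v x) k′ → ∣ S ∣ ∸ 1 ≤ k′
  gp∸1≤gp-v {S} gpS preserves (_ , maximal) =
    ≤-trans (∣removeAt∣ S x) (maximal _ (removeAt-IsGPSet gpS preserves))

corollary5p3 : ∀ {n} (G : Graph (suc n)) (x : Fin (suc n)) (k k′ : ℕ) →
    ConnectedDiam2 G →
    (ConnectedDiam2 (G -v x) ⊎ (∃[ S ] (IsGPSet G S × ∣ S ∣ ≡ k × x ∈ S))) →
    IsGP G k → IsGP (G -v x) k′ →
    (k ∸ 1 ≤ k′) × (k′ ≤ k)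
corollary5p3 G x k k′ (diam , _) hyp gpG@((S₀ , gpS₀ , ∣S₀∣≡k) , _) gpH =
  lower hyp , gp-v≤gp diam gpG gpH
  where
  open VertexDeletion G x
  fromBypassable : ∀ {S} → IsGPSet G S → ∣ S ∣ ≡ k → Bypassable S → k ∸ 1 ≤ k′
  fromBypassable gpS ∣S∣≡k bypass = subst (λ m → m ∸ 1 ≤ k′) ∣S∣≡k
    (gp∸1≤gp-v gpS (Bypassable⇒PreservesDistOn diam bypass) gpH)
  lower : ConnectedDiam2 (G -v x) ⊎ (∃[ S ] (IsGPSet G S × ∣ S ∣ ≡ k × x ∈ S)) →
          k ∸ 1 ≤ k′
  lower (inj₁ (diamH , _)) =
    fromBypassable gpS₀ ∣S₀∣≡k (Diam≤2⇒Bypassable diamH)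
  lower (inj₂ (S , gpS , ∣S∣≡k , x∈S)) =
    fromBypassable gpS ∣S∣≡k (IsGPSet-∋⇒Bypassable gpS x∈S)
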